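{- Let $t\ge 0$ and $n\ge 1$ be integers with $t(t+3)\le 2n<(t+1)(t+4)$, and let $K_{n,n}$ be the complete bipartite graph with both parts of size $n$. Then $K_{n,n}$ has an equitable $(q,\infty,2)$-tree-coloring for every positive integer $q\ge 2\lfloor\frac{t+1}{2}\rfloor$.
   Context: A $q$-coloring of a graph $G$ is a map $f:V(G)\to\{1,\dots,q\}$ (not necessarily surjective); its color classes are $V_i=f^{ -1}(i)$. It is equitable if $||V_i|-|V_j||\le 1$ for all $i,j$. It is a $(q,\infty,2)$-tree-coloring if for every $i$, each connected component of $G[V_i]$ is a tree of diameter at most $2$ (no restriction on maximum degree). -}

module Defs where

open import Data.Nat using (ℕ; zero; suc; pred; _+_; _*_; _≤_; _<_)
open import Data.Fin using (Fin; toℕ; _≟_)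
open import Data.List using (List; []; _∷_; length; filter; last)
open import Data.List.Relation.Unary.All using (All)
open import Data.List.Relation.Unary.Linked using (Linked)
open import Data.List.Relation.Unary.Unique.Propositional using (Unique)
open import Data.List using (allFin) renaming (head to hd)
open import Data.Maybe using (just)
open import Data.Product using (Σ; _×_; _,_)
open import Data.Empty using (⊥)
open import Data.Nat.Properties using (<⇒≱)
open import Data.Sum using (_⊎_; inj₁; inj₂)
open import Relation.Binary.PropositionalEquality using (_≡_)
open import Relation.Nullary using (¬_)

record Graph : Set₁ where
  field
    V   : ℕ
    Adj : Fin V → Fin V → Set
    sym : ∀ {u v} → Adj u v → Adj v u
    irr : ∀ {u} → ¬ Adj u u

open Graph public

K : ℕ → Graph
K n = record
  { V = n + n
  ; Adj = λ u v → (toℕ u < n × n ≤ toℕ v) ⊎ (n ≤ toℕ u × toℕ v < n)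
  ; sym = λ { (inj₁ (a , b)) → inj₂ (b , a)
            ; (inj₂ (a , b)) → inj₁ (b , a) }
  ; irr = λ { (inj₁ (a , b)) → <-irr a b
            ; (inj₂ (a , b)) → <-irr b a }
  }
  where
  <-irr : ∀ {x} → x < n → n ≤ x → ⊥
  <-irr a b = <⇒≱ a b

-- A q-coloring of G (not necessarily surjective); colors are Fin q ≅ {1,…,q}.
Coloring : Graph → ℕ → Set
Coloring G q = Fin (V G) → Fin q

classSize : (G : Graph) {q : ℕ} → Coloring G q → Fin q → ℕ
classSize G f c = length (filter (λ v → f v ≟ c) (allFin (V G)))

Equitable : (G : Graph) {q : ℕ} → Coloring G q → Set
Equitable G f = ∀ i j → classSize G f i ≤ suc (classSize G f j)

record WalkIn (G : Graph) {q : ℕ} (f : Coloring G q) (c : Fin q)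
              (u v : Fin (V G)) : Set where
  field
    verts   : List (Fin (V G))
    colored : All (λ w → f w ≡ c) verts
    linked  : Linked (Adj G) verts
    start   : hd verts ≡ just u
    end     : last verts ≡ just v

walkLength : ∀ {G q f c u v} → WalkIn G {q} f c u v → ℕ
walkLength w = pred (length (WalkIn.verts w))

CycleIn : (G : Graph) {q : ℕ} → Coloring G q → Fin q → Set
CycleIn G f c =
  Σ (Fin (V G)) λ x₀ → Σ (Fin (V G)) λ x₁ → Σ (Fin (V G)) λ x₂ →
  Σ (List (Fin (V G))) λ rest →
    let xs = x₀ ∷ x₁ ∷ x₂ ∷ rest in
    All (λ w → f w ≡ c) xs × Unique xs × Linked (Adj G) xs ×
    Σ (Fin (V G)) λ xk → (last xs ≡ just xk) × Adj G xk x₀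

-- (q,∞,2)-tree-coloring: for every color c, every connected component of G[V_c]
-- is a tree (G[V_c] has no cycle) of diameter at most 2 (any two vertices in the
-- same component, i.e. joined by a walk in G[V_c], are at distance ≤ 2 in G[V_c]).
TreeColoring : (G : Graph) {q : ℕ} → Coloring G q → Set
TreeColoring G {q} f = ∀ (c : Fin q) →
  (¬ CycleIn G f c) ×
  (∀ u v → WalkIn G f c u v →
     Σ (WalkIn G f c u v) λ w → walkLength w ≤ 2)

EquitableTreeColoring : Graph → ℕ → Set
EquitableTreeColoring G q =
  Σ (Coloring G q) λ f → Equitable G f × TreeColoring G f

-- In K_{n,n} a colour class with a vertices in the first part and b in the second induces
-- K_{a,b}, which is a forest of trees of diameter at most 2 exactly when min(a, b) ≤ 1.  Writing
-- 2n = mQ + r with 0 ≤ r < Q, the classes have sizes m or m + 1, and it remains to split each size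
-- as a_i + b_i with min(a_i, b_i) ≤ 1 and Σ a_i = n.  If m = 0 every class has at most one vertex.
-- Otherwise let p = ⌊Q/2⌋ colours take all but one of their vertices in the first part and the
-- others at most one; moving one extra vertex of each of the first D colours into the first part
-- reaches Σ a_i = n for some 0 ≤ D ≤ Q exactly when X ≤ n ≤ X + Q, X = p(m - 1) + min(p, r).  For
-- even Q this always holds; for odd Q it needs m ≤ Q + 2, i.e. 2n < Q(Q + 3), and the extreme
-- cases are excluded by parity.  An odd number q of colours with q ≥ 2⌊(t+1)/2⌋ satisfies q ≥ t + 1,
-- so 2n < (t+1)(t+4) gives 2n < q(q+3).

module Submission where

open import Data.Bool using (Bool; true; false; _∧_; not)
open import Data.Bool.Properties using (∧-zeroʳ)
open import Data.Empty using (⊥-elim)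
open import Data.Fin using (Fin; toℕ; _≟_; zero; suc)
open import Data.Fin.Properties using (toℕ-injective; toℕ<n)
open import Data.List
  using (List; []; _∷_; _++_; length; filter; map; replicate; tabulate; allFin; last)
open import Data.List.Properties using (length-++; length-map; length-replicate; filter-++; map-tabulate)
open import Data.List.Relation.Unary.All using (All; []; _∷_)
open import Data.List.Relation.Unary.All.Properties using (last⁺)
open import Data.List.Relation.Unary.AllPairs using (_∷_)
open import Data.List.Relation.Unary.Linked using ([-]; _∷_)
open import Data.Maybe using (just)
import Data.Maybe.Relation.Unary.All as Maybe
open import Data.Maybe.Relation.Unary.All using (drop-just)
open import Data.Nat using (ℕ; zero; suc; _+_; _*_; _∸_; _⊓_; _/_; _%_; _≤_; _<_; _<ᵇ_; z≤n; s≤s; _<?_)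
open import Data.Nat.DivMod using (m≡m%n+[m/n]*n; m%n<n)
open import Data.Nat.Properties
  using (≤-refl; ≤-reflexive; ≤-trans; <-≤-trans; ≤-pred; n≤1+n; <⇒≤; <⇒≱; ≮⇒≥; m≤n⇒m<n∨m≡n;
         +-suc; +-comm; +-assoc; +-identityʳ; +-cancelˡ-≡; +-cancelʳ-<; +-mono-≤; +-monoˡ-≤; +-monoʳ-≤;
         *-comm; *-assoc; *-suc; *-identityˡ; *-distribˡ-+; *-distribˡ-⊓; *-mono-≤; *-monoˡ-≤; *-monoʳ-≤;
         *-cancelˡ-≤; *-cancelˡ-<; *-cancelʳ-<; m≤m+n; m≤n+m; m∸n+n≡m; m+[n∸m]≡n; m≤n+o⇒m∸n≤o;
         m⊓n≤m; m≥n⇒m⊓n≡n; ⊓-glb; ⊓-zeroʳ; even≢odd; +-*-semiring; module ≤-Reasoning)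
open import Algebra.Properties.Semiring.Sum +-*-semiring
  using (sum-syntax; sum-cong-≗; ∑-distrib-+; *-distribʳ-sum)
open import Data.Nat.Tactic.RingSolver using (solve-∀)
open import Data.Product using (Σ; ∃; _×_; _,_)
open import Data.Sum using (_⊎_; inj₁; inj₂)
open import Defs hiding (sym)
open import Function using (_∘_)
open import Relation.Binary.PropositionalEquality
  using (_≡_; refl; sym; trans; cong; cong₂; subst; module ≡-Reasoning)
open import Relation.Nullary using (¬_; yes; no)

count : ∀ {Q} → Fin Q → List (Fin Q) → ℕ
count c xs = length (filter (_≟ c) xs)

nth : ∀ {A : Set} → List A → A → ℕ → A
nth []       d _       = d
nth (x ∷ xs) d zero    = x
nth (x ∷ xs) d (suc i) = nth xs d i

count-++ : ∀ {Q} (c : Fin Q) xs ys → count c (xs ++ ys) ≡ count c xs + count c ys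
count-++ c xs ys = trans (cong length (filter-++ (_≟ c) xs ys)) (length-++ (filter (_≟ c) xs))

count-map : ∀ {A : Set} {Q} (g : A → Fin Q) c xs →
            length (filter (λ x → g x ≟ c) xs) ≡ count c (map g xs)
count-map g c []       = refl
count-map g c (x ∷ xs) with g x ≟ c
... | yes _ = cong suc (count-map g c xs)
... | no  _ = count-map g c xs

tabulate-nth : ∀ {A : Set} (d : A) {N} xs → length xs ≡ N → tabulate {n = N} (nth xs d ∘ toℕ) ≡ xs
tabulate-nth d []       refl = refl
tabulate-nth d (x ∷ xs) refl = cong (x ∷_) (tabulate-nth d xs refl)

nth-++ˡ : ∀ {A : Set} (d : A) xs ys {i} → i < length xs → nth (xs ++ ys) d i ≡ nth xs d i
nth-++ˡ d (x ∷ xs) ys {zero}  _         = refl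
nth-++ˡ d (x ∷ xs) ys {suc i} (s≤s i<) = nth-++ˡ d xs ys i<

nth-++ʳ : ∀ {A : Set} (d : A) xs ys {i} → length xs ≤ i → nth (xs ++ ys) d i ≡ nth ys d (i ∸ length xs)
nth-++ʳ d []       ys _         = refl
nth-++ʳ d (x ∷ xs) ys (s≤s xs≤) = nth-++ʳ d xs ys xs≤

nth⇒1≤count : ∀ {Q} (d c : Fin Q) xs {i} → i < length xs → nth xs d i ≡ c → 1 ≤ count c xs
nth⇒1≤count d c (x ∷ xs) {i} i< xᵢ≡c with x ≟ c
nth⇒1≤count d c (x ∷ xs) {i}     _        _    | yes _ = s≤s z≤n
nth⇒1≤count d c (x ∷ xs) {zero}  _        x≡c  | no x≢c = ⊥-elim (x≢c x≡c)
nth⇒1≤count d c (x ∷ xs) {suc i} (s≤s i<) xᵢ≡c | no _   = nth⇒1≤count d c xs i< xᵢ≡c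

count-self : ∀ {Q} (x : Fin Q) xs → count x (x ∷ xs) ≡ suc (count x xs)
count-self x xs with x ≟ x
... | yes _  = refl
... | no x≢x = ⊥-elim (x≢x refl)

count-∷ : ∀ {Q} (c x : Fin Q) xs → count c xs ≤ count c (x ∷ xs)
count-∷ c x xs with x ≟ c
... | yes _ = n≤1+n (count c xs)
... | no  _ = ≤-refl

count≤1⇒nth-injective : ∀ {Q} (d c : Fin Q) xs {i j} → count c xs ≤ 1 →
  i < length xs → j < length xs → nth xs d i ≡ c → nth xs d j ≡ c → i ≡ j
count≤1⇒nth-injective d c (x ∷ xs) {zero}  {zero}  _  _        _        _    _    = refl
count≤1⇒nth-injective d c (x ∷ xs) {zero}  {suc j} ≤1 _        (s≤s j<) refl xⱼ≡x =
  ⊥-elim (<⇒≱ (s≤s (nth⇒1≤count d x xs j< xⱼ≡x)) (subst (_≤ 1) (count-self x xs) ≤1))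
count≤1⇒nth-injective d c (x ∷ xs) {suc i} {zero}  ≤1 (s≤s i<) _        xᵢ≡x refl =
  ⊥-elim (<⇒≱ (s≤s (nth⇒1≤count d x xs i< xᵢ≡x)) (subst (_≤ 1) (count-self x xs) ≤1))
count≤1⇒nth-injective d c (x ∷ xs) {suc i} {suc j} ≤1 (s≤s i<) (s≤s j<) xᵢ≡c xⱼ≡c =
  cong suc (count≤1⇒nth-injective d c xs (≤-trans (count-∷ c x xs) ≤1) i< j< xᵢ≡c xⱼ≡c)

All-last : ∀ {A : Set} {P : A → Set} {xs x} → All P xs → last xs ≡ just x → P x
All-last ps eq = drop-just (subst (Maybe.All _) eq (last⁺ ps))

Bipartition : (G : Graph) → (Fin (V G) → Set) → Set
Bipartition G P = ∀ {u v} → Adj G u v → (P u × ¬ P v) ⊎ (¬ P u × P v)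

-- A cycle meets the side P in two distinct vertices: x₀ and x₂, or x₁ and the last vertex.
bipartition-unique⇒¬cycle : ∀ {G q P} {f : Coloring G q} {c} → Bipartition G P →
  (∀ {u v} → P u → P v → f u ≡ c → f v ≡ c → u ≡ v) → ¬ CycleIn G f c
bipartition-unique⇒¬cycle bip uniq
  (x₀ , x₁ , x₂ , _ , f₀ ∷ f₁ ∷ f₂ ∷ fs , (_ ∷ x₀≢x₂ ∷ _) ∷ (x₁≢later ∷ _) ,
   x₀x₁ ∷ x₁x₂ ∷ _ , _ , lastₖ , xₖx₀) with bip x₀x₁ | bip x₁x₂ | bip xₖx₀
... | inj₁ (P₀ , _)  | inj₂ (_ , P₂) | _ = x₀≢x₂ (uniq P₀ P₂ f₀ f₂)
... | inj₁ (_ , ¬P₁) | inj₁ (P₁ , _) | _ = ¬P₁ P₁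
... | inj₂ (_ , P₁)  | _ | inj₁ (Pₖ , _) =
  All-last x₁≢later lastₖ (uniq P₁ Pₖ f₁ (All-last (f₀ ∷ f₁ ∷ f₂ ∷ fs) lastₖ))
... | inj₂ (¬P₀ , _) | _ | inj₂ (_ , P₀) = ¬P₀ P₀

module _ {n : ℕ} where

  K-bipartitionA : Bipartition (K n) (λ v → toℕ v < n)
  K-bipartitionA (inj₁ (u<n , n≤v)) = inj₁ (u<n , λ v<n → <⇒≱ v<n n≤v)
  K-bipartitionA (inj₂ (n≤u , v<n)) = inj₂ ((λ u<n → <⇒≱ u<n n≤u) , v<n)

  K-bipartitionB : Bipartition (K n) (λ v → n ≤ toℕ v)
  K-bipartitionB (inj₁ (u<n , n≤v)) = inj₂ (<⇒≱ u<n , n≤v)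
  K-bipartitionB (inj₂ (n≤u , v<n)) = inj₁ (n≤u , <⇒≱ v<n)

  K-neighbourA : ∀ {u w v} → Adj (K n) u w → toℕ u < n → toℕ v < n → Adj (K n) w v
  K-neighbourA (inj₁ (_ , n≤w)) _   v<n = inj₂ (n≤w , v<n)
  K-neighbourA (inj₂ (n≤u , _)) u<n _   = ⊥-elim (<⇒≱ u<n n≤u)

  K-neighbourB : ∀ {u w v} → Adj (K n) u w → ¬ toℕ u < n → ¬ toℕ v < n → Adj (K n) w v
  K-neighbourB (inj₁ (u<n , _)) u≮n _   = ⊥-elim (u≮n u<n)
  K-neighbourB (inj₂ (_ , w<n)) _   v≮n = inj₁ (w<n , ≮⇒≥ v≮n)

  ShortWalk : ∀ {q} → Coloring (K n) q → Fin q → Fin (n + n) → Fin (n + n) → Set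
  ShortWalk f c u v = Σ (WalkIn (K n) f c u v) λ w → walkLength w ≤ 2

  edgeWalk : ∀ {q} {f : Coloring (K n) q} {c u v} → f u ≡ c → f v ≡ c → Adj (K n) u v → ShortWalk f c u v
  edgeWalk {u = u} {v} fu fv uv =
    record { verts = u ∷ v ∷ [] ; colored = fu ∷ fv ∷ [] ; linked = uv ∷ [-] ; start = refl ; end = refl }
    , s≤s z≤n

  pathWalk : ∀ {q} {f : Coloring (K n) q} {c u w v} → f u ≡ c → f w ≡ c → f v ≡ c →
             Adj (K n) u w → Adj (K n) w v → ShortWalk f c u v
  pathWalk {u = u} {w} {v} fu fw fv uw wv =
    record { verts = u ∷ w ∷ v ∷ [] ; colored = fu ∷ fw ∷ fv ∷ [] ; linked = uw ∷ wv ∷ [-]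
           ; start = refl ; end = refl }
    , ≤-refl

  -- Vertices on different sides are adjacent; on the same side they share the neighbour w.
  shortcut-via : ∀ {q} {f : Coloring (K n) q} {c u w v} → f u ≡ c → f w ≡ c → f v ≡ c →
                 Adj (K n) u w → ShortWalk f c u v
  shortcut-via {u = u} {v = v} fu fw fv uw with toℕ u <? n | toℕ v <? n
  ... | yes u<n | no  v≮n = edgeWalk fu fv (inj₁ (u<n , ≮⇒≥ v≮n))
  ... | no  u≮n | yes v<n = edgeWalk fu fv (inj₂ (≮⇒≥ u≮n , v<n))
  ... | yes u<n | yes v<n = pathWalk fu fw fv uw (K-neighbourA uw u<n v<n)
  ... | no  u≮n | no  v≮n = pathWalk fu fw fv uw (K-neighbourB uw u≮n v≮n)

  K-shortcut : ∀ {q} {f : Coloring (K n) q} {c u v} → WalkIn (K n) f c u v → ShortWalk f c u v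
  K-shortcut w@record { verts = _ ∷ [] } = w , z≤n
  K-shortcut record { verts = _ ∷ _ ∷ _ ; colored = fu ∷ fw ∷ fws ; linked = uw ∷ _ ; start = refl ; end = end } =
    shortcut-via fu fw (All-last (fu ∷ fw ∷ fws) end) uw

module SideColoring {n q : ℕ} (LA LB : List (Fin (suc q)))
                     (|LA| : length LA ≡ n) (|LB| : length LB ≡ n) where

  coloring : Coloring (K n) (suc q)
  coloring v = nth (LA ++ LB) zero (toℕ v)

  classSize-coloring : ∀ c → classSize (K n) coloring c ≡ count c LA + count c LB
  classSize-coloring c = begin
    length (filter (λ v → coloring v ≟ c) (allFin (n + n))) ≡⟨ count-map coloring c (allFin (n + n)) ⟩
    count c (map coloring (tabulate (λ v → v)))             ≡⟨ cong (count c) (map-tabulate (λ v → v) coloring) ⟩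
    count c (tabulate coloring)                              ≡⟨ cong (count c) (tabulate-nth zero (LA ++ LB) |LA++LB|) ⟩
    count c (LA ++ LB)                                        ≡⟨ count-++ c LA LB ⟩
    count c LA + count c LB                                   ∎
    where
    open ≡-Reasoning
    |LA++LB| : length (LA ++ LB) ≡ n + n
    |LA++LB| = trans (length-++ LA) (cong₂ _+_ |LA| |LB|)

  unique-in-A : ∀ c → count c LA ≤ 1 → ∀ {u v} → toℕ u < n → toℕ v < n →
                coloring u ≡ c → coloring v ≡ c → u ≡ v
  unique-in-A c ≤1 {u} {v} u< v< fu fv = toℕ-injective
    (count≤1⇒nth-injective zero c LA ≤1 u<′ v<′
      (trans (sym (nth-++ˡ zero LA LB u<′)) fu) (trans (sym (nth-++ˡ zero LA LB v<′)) fv))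
    where
    u<′ = subst (toℕ u <_) (sym |LA|) u<
    v<′ = subst (toℕ v <_) (sym |LA|) v<

  unique-in-B : ∀ c → count c LB ≤ 1 → ∀ {u v} → n ≤ toℕ u → n ≤ toℕ v →
                coloring u ≡ c → coloring v ≡ c → u ≡ v
  unique-in-B c ≤1 {u} {v} n≤u n≤v fu fv = toℕ-injective (begin
    toℕ u           ≡⟨ sym (m∸n+n≡m n≤u) ⟩
    toℕ u ∸ n + n   ≡⟨ cong (_+ n) (count≤1⇒nth-injective zero c LB ≤1 (index< n≤u) (index< n≤v)
                                      (inB n≤u fu) (inB n≤v fv)) ⟩
    toℕ v ∸ n + n   ≡⟨ m∸n+n≡m n≤v ⟩
    toℕ v           ∎)
    where
    open ≡-Reasoning
    index< : ∀ {w : Fin (n + n)} → n ≤ toℕ w → toℕ w ∸ n < length LB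
    index< {w} n≤w = subst (toℕ w ∸ n <_) (sym |LB|)
      (+-cancelʳ-< n (toℕ w ∸ n) n (subst (_< n + n) (sym (m∸n+n≡m n≤w)) (toℕ<n w)))
    inB : ∀ {w} → n ≤ toℕ w → coloring w ≡ c → nth LB zero (toℕ w ∸ n) ≡ c
    inB {w} n≤w fw = subst (λ k → nth LB zero (toℕ w ∸ k) ≡ c) |LA|
      (trans (sym (nth-++ʳ zero LA LB (subst (_≤ toℕ w) (sym |LA|) n≤w))) fw)

  equitable : (∀ i j → count i LA + count i LB ≤ suc (count j LA + count j LB)) →
              Equitable (K n) coloring
  equitable balanced i j rewrite classSize-coloring i | classSize-coloring j = balanced i j

  treeColoring : (∀ c → count c LA ≤ 1 ⊎ count c LB ≤ 1) → TreeColoring (K n) coloring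
  treeColoring star c = acyclic (star c) , λ _ _ → K-shortcut
    where
    acyclic : count c LA ≤ 1 ⊎ count c LB ≤ 1 → ¬ CycleIn (K n) coloring c
    acyclic (inj₁ ≤1) = bipartition-unique⇒¬cycle {K n} K-bipartitionA (unique-in-A c ≤1)
    acyclic (inj₂ ≤1) = bipartition-unique⇒¬cycle {K n} K-bipartitionB (unique-in-B c ≤1)

count-replicate-self : ∀ {Q} (c : Fin Q) k → count c (replicate k c) ≡ k
count-replicate-self c zero = refl
count-replicate-self c (suc k) with c ≟ c
... | yes _  = cong suc (count-replicate-self c k)
... | no c≢c = ⊥-elim (c≢c refl)

count-replicate-zero : ∀ {Q} (c : Fin Q) k → count (suc c) (replicate k zero) ≡ 0
count-replicate-zero c zero    = refl
count-replicate-zero c (suc k) = count-replicate-zero c k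

count-map-suc-zero : ∀ {Q} (xs : List (Fin Q)) → count zero (map suc xs) ≡ 0
count-map-suc-zero []       = refl
count-map-suc-zero (x ∷ xs) = count-map-suc-zero xs

count-map-suc : ∀ {Q} (c : Fin Q) xs → count (suc c) (map suc xs) ≡ count c xs
count-map-suc c []       = refl
count-map-suc c (x ∷ xs) with x ≟ c
... | yes _ = cong suc (count-map-suc c xs)
... | no  _ = count-map-suc c xs

blocks : ∀ {Q} → (Fin Q → ℕ) → List (Fin Q)
blocks {zero}  g = []
blocks {suc Q} g = replicate (g zero) zero ++ map suc (blocks (g ∘ suc))

length-blocks : ∀ {Q} (g : Fin Q → ℕ) → length (blocks g) ≡ ∑[ i < Q ] g i
length-blocks {zero}  g = refl
length-blocks {suc Q} g = begin
  length (replicate (g zero) zero ++ map suc (blocks (g ∘ suc)))  ≡⟨ length-++ (replicate (g zero) zero) ⟩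
  length (replicate (g zero) zero) + length (map suc (blocks (g ∘ suc)))
    ≡⟨ cong₂ _+_ (length-replicate (g zero)) (length-map suc (blocks (g ∘ suc))) ⟩
  g zero + length (blocks (g ∘ suc))                              ≡⟨ cong (g zero +_) (length-blocks (g ∘ suc)) ⟩
  g zero + ∑[ i < Q ] g (suc i)                                   ∎
  where open ≡-Reasoning

count-blocks : ∀ {Q} (g : Fin Q → ℕ) c → count c (blocks g) ≡ g c
count-blocks {suc Q} g c = trans (count-++ c (replicate (g zero) zero) (map suc (blocks (g ∘ suc)))) (split c)
  where
  split : ∀ c → count c (replicate (g zero) zero) + count c (map suc (blocks (g ∘ suc))) ≡ g c
  split zero    = trans (cong₂ _+_ (count-replicate-self zero (g zero)) (count-map-suc-zero (blocks (g ∘ suc))))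
                        (+-identityʳ (g zero))
  split (suc c) = trans (cong₂ _+_ (count-replicate-zero c (g zero)) (count-map-suc c (blocks (g ∘ suc))))
                        (count-blocks (g ∘ suc) c)

-- Colour i is used on a i vertices of the first part and on b i vertices of the second.
record StarProfile (n Q : ℕ) : Set where
  field
    a b      : Fin Q → ℕ
    ∑a       : ∑[ i < Q ] a i ≡ n
    ∑b       : ∑[ i < Q ] b i ≡ n
    balanced : ∀ i j → a i + b i ≤ suc (a j + b j)
    star     : ∀ i → a i ≤ 1 ⊎ b i ≤ 1

starProfile⇒coloring : ∀ {n q} → StarProfile n (suc q) → EquitableTreeColoring (K n) (suc q)
starProfile⇒coloring P = coloring , equitable balanced′ , treeColoring star′
  where
  open StarProfile P
  open SideColoring (blocks a) (blocks b) (trans (length-blocks a) ∑a) (trans (length-blocks b) ∑b)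
  balanced′ : ∀ i j → count i (blocks a) + count i (blocks b) ≤ suc (count j (blocks a) + count j (blocks b))
  balanced′ i j rewrite count-blocks a i | count-blocks b i | count-blocks a j | count-blocks b j = balanced i j
  star′ : ∀ c → count c (blocks a) ≤ 1 ⊎ count c (blocks b) ≤ 1
  star′ c rewrite count-blocks a c | count-blocks b c = star c

bit : Bool → ℕ
bit false = 0
bit true  = 1

bit≤1 : ∀ b → bit b ≤ 1
bit≤1 false = z≤n
bit≤1 true  = s≤s z≤n

[_<_] : ℕ → ℕ → ℕ
[ i < x ] = bit (i <ᵇ x)

[<]-mono : ∀ i {x y} → x ≤ y → [ i < x ] ≤ [ i < y ]
[<]-mono i       {zero}           _         = z≤n
[<]-mono zero    {suc _} {suc _} _         = ≤-refl
[<]-mono (suc i) {suc _} {suc _} (s≤s x≤y) = [<]-mono i x≤y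

<ᵇ-⊓ : ∀ i x y → (i <ᵇ x) ∧ (i <ᵇ y) ≡ (i <ᵇ x ⊓ y)
<ᵇ-⊓ i       zero    y       = refl
<ᵇ-⊓ zero    (suc x) zero    = refl
<ᵇ-⊓ (suc i) (suc x) zero    = ∧-zeroʳ (i <ᵇ x)
<ᵇ-⊓ zero    (suc x) (suc y) = refl
<ᵇ-⊓ (suc i) (suc x) (suc y) = <ᵇ-⊓ i x y

∑[<] : ∀ Q x → ∑[ i < Q ] [ toℕ i < x ] ≡ Q ⊓ x
∑[<] zero    x       = refl
∑[<] (suc Q) zero    = trans (∑[<] Q zero) (⊓-zeroʳ Q)
∑[<] (suc Q) (suc x) = cong suc (∑[<] Q x)

∑[<]-≤ : ∀ {Q x} → x ≤ Q → ∑[ i < Q ] [ toℕ i < x ] ≡ x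
∑[<]-≤ {Q} {x} x≤Q = trans (∑[<] Q x) (m≥n⇒m⊓n≡n x≤Q)

∑-const : ∀ Q k → ∑[ i < Q ] k ≡ Q * k
∑-const zero    k = refl
∑-const (suc Q) k = cong (k +_) (∑-const Q k)

∑-cancel : ∀ {Q n} (a b : Fin Q → ℕ) → ∑[ i < Q ] a i ≡ n → ∑[ i < Q ] (a i + b i) ≡ 2 * n →
           ∑[ i < Q ] b i ≡ n
∑-cancel {Q} {n} a b ∑a ∑ab = +-cancelˡ-≡ n _ _ (begin
  n + ∑[ i < Q ] b i              ≡⟨ cong (_+ ∑[ i < Q ] b i) (sym ∑a) ⟩
  ∑[ i < Q ] a i + ∑[ i < Q ] b i ≡⟨ sym (∑-distrib-+ a b) ⟩
  ∑[ i < Q ] (a i + b i)          ≡⟨ ∑ab ⟩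
  2 * n                           ≡⟨ cong (n +_) (+-identityʳ n) ⟩
  n + n                           ∎)
  where open ≡-Reasoning

nearly-constant⇒balanced : ∀ {Q} (a b ε : Fin Q → ℕ) k → (∀ i → a i + b i ≡ k + ε i) → (∀ i → ε i ≤ 1) →
                ∀ i j → a i + b i ≤ suc (a j + b j)
nearly-constant⇒balanced a b ε k ab≡ ε≤1 i j rewrite ab≡ i | ab≡ j =
  ≤-trans (+-monoʳ-≤ k (ε≤1 i)) (≤-trans (+-monoʳ-≤ k (s≤s z≤n)) (≤-reflexive (+-suc k (ε j))))

fewColorsProfile : ∀ {n Q} → 2 * n ≤ Q → StarProfile n Q
fewColorsProfile {n} {Q} 2n≤Q = record
  { a = a ; b = b ; ∑a = ∑a ; ∑b = ∑-cancel a b ∑a ∑ab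
  ; balanced = nearly-constant⇒balanced a b (λ i → [ toℕ i < 2 * n ]) 0 a+b (λ i → bit≤1 _)
  ; star = λ i → inj₁ (bit≤1 _) }
  where
  a b : Fin Q → ℕ
  a i = [ toℕ i < n ]
  b i = [ toℕ i < 2 * n ] ∸ [ toℕ i < n ]
  a+b : ∀ i → a i + b i ≡ [ toℕ i < 2 * n ]
  a+b i = m+[n∸m]≡n ([<]-mono (toℕ i) (m≤m+n n (n + 0)))
  ∑a : ∑[ i < Q ] a i ≡ n
  ∑a = ∑[<]-≤ (≤-trans (m≤m+n n (n + 0)) 2n≤Q)
  ∑ab : ∑[ i < Q ] (a i + b i) ≡ 2 * n
  ∑ab = trans (sum-cong-≗ a+b) (∑[<]-≤ 2n≤Q)

-- Split of a class of size m + 1 + bit big: a heavy colour puts all but one vertex in the first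
-- part, a light one none, and extra moves one more vertex to the first part.
heavyA heavyB : ℕ → Bool → Bool → Bool → ℕ
heavyA m true  big extra = m + bit big + bit extra
heavyA m false big extra = bit extra
heavyB m true  big extra = bit (not extra)
heavyB m false big extra = m + bit big + bit (not extra)

heavyA-linear : ∀ m heavy big extra → heavyA m heavy big extra ≡ bit heavy * m + bit (heavy ∧ big) + bit extra
heavyA-linear m true  big extra = cong (λ x → x + bit big + bit extra) (sym (+-identityʳ m))
heavyA-linear m false big extra = refl

heavyA+heavyB : ∀ m heavy big extra → heavyA m heavy big extra + heavyB m heavy big extra ≡ suc m + bit big
heavyA+heavyB m true  big true  = trans (+-identityʳ _) (+-comm _ 1)
heavyA+heavyB m true  big false = trans (cong (_+ 1) (+-identityʳ _)) (+-comm _ 1)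
heavyA+heavyB m false big true  = cong suc (+-identityʳ _)
heavyA+heavyB m false big false = +-comm _ 1

heavy-star : ∀ m heavy big extra → heavyA m heavy big extra ≤ 1 ⊎ heavyB m heavy big extra ≤ 1
heavy-star m true  big extra = inj₂ (bit≤1 (not extra))
heavy-star m false big extra = inj₁ (bit≤1 extra)

windowProfile : ∀ {n Q p m r} → p ≤ Q → r < Q → 2 * n ≡ r + suc m * Q →
                p * m + p ⊓ r ≤ n → n ≤ p * m + p ⊓ r + Q → StarProfile n Q
windowProfile {n} {Q} {p} {m} {r} p≤Q r<Q 2n≡ load≤n n≤load+Q = record
  { a = a ; b = b ; ∑a = ∑a ; ∑b = ∑-cancel a b ∑a ∑ab
  ; balanced = nearly-constant⇒balanced a b (λ i → [ toℕ i < r ]) (suc m) a+b (λ i → bit≤1 _)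
  ; star = λ i → heavy-star m (heavy i) (big i) (extra i) }
  where
  load = p * m + p ⊓ r
  D = n ∸ load
  heavy big extra : Fin Q → Bool
  heavy i = toℕ i <ᵇ p
  big   i = toℕ i <ᵇ r
  extra i = toℕ i <ᵇ D
  a b : Fin Q → ℕ
  a i = heavyA m (heavy i) (big i) (extra i)
  b i = heavyB m (heavy i) (big i) (extra i)
  a+b : ∀ i → a i + b i ≡ suc m + [ toℕ i < r ]
  a+b i = heavyA+heavyB m (heavy i) (big i) (extra i)
  open ≡-Reasoning
  ∑a : ∑[ i < Q ] a i ≡ n
  ∑a = begin
    ∑[ i < Q ] a i
      ≡⟨ sum-cong-≗ (λ i → trans (heavyA-linear m (heavy i) (big i) (extra i))
                                   (cong (λ x → [ toℕ i < p ] * m + bit x + [ toℕ i < D ]) (<ᵇ-⊓ (toℕ i) p r))) ⟩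
    ∑[ i < Q ] ([ toℕ i < p ] * m + [ toℕ i < p ⊓ r ] + [ toℕ i < D ])
      ≡⟨ ∑-distrib-+ {Q} (λ i → [ toℕ i < p ] * m + [ toℕ i < p ⊓ r ]) (λ i → [ toℕ i < D ]) ⟩
    ∑[ i < Q ] ([ toℕ i < p ] * m + [ toℕ i < p ⊓ r ]) + ∑[ i < Q ] [ toℕ i < D ]
      ≡⟨ cong (_+ ∑[ i < Q ] [ toℕ i < D ]) (∑-distrib-+ {Q} (λ i → [ toℕ i < p ] * m) (λ i → [ toℕ i < p ⊓ r ])) ⟩
    ∑[ i < Q ] ([ toℕ i < p ] * m) + ∑[ i < Q ] [ toℕ i < p ⊓ r ] + ∑[ i < Q ] [ toℕ i < D ]
      ≡⟨ cong (λ x → x + ∑[ i < Q ] [ toℕ i < p ⊓ r ] + ∑[ i < Q ] [ toℕ i < D ])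
              (sym (*-distribʳ-sum {Q} m (λ i → [ toℕ i < p ]))) ⟩
    ∑[ i < Q ] [ toℕ i < p ] * m + ∑[ i < Q ] [ toℕ i < p ⊓ r ] + ∑[ i < Q ] [ toℕ i < D ]
      ≡⟨ cong₂ _+_ (cong₂ _+_ (cong (_* m) (∑[<]-≤ p≤Q)) (∑[<]-≤ (≤-trans (m⊓n≤m p r) p≤Q)))
                   (∑[<]-≤ (m≤n+o⇒m∸n≤o n load n≤load+Q)) ⟩
    load + D
      ≡⟨ m+[n∸m]≡n load≤n ⟩
    n ∎
  ∑ab : ∑[ i < Q ] (a i + b i) ≡ 2 * n
  ∑ab = begin
    ∑[ i < Q ] (a i + b i)                        ≡⟨ sum-cong-≗ a+b ⟩
    ∑[ i < Q ] (suc m + [ toℕ i < r ])            ≡⟨ ∑-distrib-+ {Q} (λ _ → suc m) (λ i → [ toℕ i < r ]) ⟩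
    ∑[ i < Q ] suc m + ∑[ i < Q ] [ toℕ i < r ]   ≡⟨ cong₂ _+_ (∑-const Q (suc m)) (∑[<]-≤ (<⇒≤ r<Q)) ⟩
    Q * suc m + r                                 ≡⟨ +-comm _ r ⟩
    r + Q * suc m                                 ≡⟨ cong (r +_) (*-comm Q (suc m)) ⟩
    r + suc m * Q                                 ≡⟨ sym 2n≡ ⟩
    2 * n                                         ∎

parity : ∀ k → (∃ λ j → k ≡ 2 * j) ⊎ (∃ λ j → k ≡ 1 + 2 * j)
parity zero = inj₁ (0 , refl)
parity (suc k) with parity k
... | inj₁ (j , refl) = inj₂ (j , refl)
... | inj₂ (j , refl) = inj₁ (suc j , cong suc (sym (+-suc j (j + 0))))

≤2*⊓ : ∀ {p r} → r ≤ 2 * p → r ≤ 2 * (p ⊓ r)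
≤2*⊓ {p} {r} r≤2p = subst (r ≤_) (sym (*-distribˡ-⊓ 2 p r)) (⊓-glb r≤2p (m≤m+n r (r + 0)))

quotient-bound : ∀ {n Q m r} → 2 * n ≡ r + suc m * Q → 2 * n < Q * (Q + 3) → m ≤ suc Q
quotient-bound {n} {Q} {m} {r} 2n≡ 2n< =
  ≤-pred (≤-pred (subst (suc (suc m) ≤_) (+-comm Q 3) (*-cancelʳ-< Q (suc m) (Q + 3) (begin-strict
    suc m * Q       ≤⟨ m≤n+m (suc m * Q) r ⟩
    r + suc m * Q   ≡⟨ sym 2n≡ ⟩
    2 * n           <⟨ 2n< ⟩
    Q * (Q + 3)     ≡⟨ *-comm Q (Q + 3) ⟩
    (Q + 3) * Q     ∎))))
  where open ≤-Reasoning

load≤n : ∀ {n Q p m r} → 2 * p ≤ Q → 2 * n ≡ r + suc m * Q → p * m + p ⊓ r ≤ n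
load≤n {n} {Q} {p} {m} {r} 2p≤Q 2n≡ = *-cancelˡ-≤ 2 (begin
  2 * (p * m + p ⊓ r)        ≡⟨ *-distribˡ-+ 2 (p * m) (p ⊓ r) ⟩
  2 * (p * m) + 2 * (p ⊓ r)  ≡⟨ cong (_+ 2 * (p ⊓ r)) (sym (*-assoc 2 p m)) ⟩
  2 * p * m + 2 * (p ⊓ r)    ≤⟨ +-mono-≤ (*-monoˡ-≤ m 2p≤Q) (≤-trans (*-monoʳ-≤ 2 (m⊓n≤m p r)) 2p≤Q) ⟩
  Q * m + Q                  ≡⟨ +-comm (Q * m) Q ⟩
  Q + Q * m                  ≡⟨ cong (Q +_) (*-comm Q m) ⟩
  suc m * Q                  ≤⟨ m≤n+m (suc m * Q) r ⟩
  r + suc m * Q              ≡⟨ sym 2n≡ ⟩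
  2 * n                      ∎)
  where open ≤-Reasoning

n≤load+Q : ∀ {n Q p e m r} → Q ≡ e + 2 * p → 2 * n ≡ r + suc m * Q →
           r + e * m ≤ 2 * (p ⊓ r) + Q → n ≤ p * m + p ⊓ r + Q
n≤load+Q {n} {Q} {p} {e} {m} {r} refl 2n≡ slack = *-cancelˡ-≤ 2 (begin
  2 * n                                  ≡⟨ 2n≡ ⟩
  r + suc m * Q                          ≡⟨ split r m e p ⟩
  r + e * m + Q + 2 * p * m              ≤⟨ +-monoˡ-≤ (2 * p * m) (+-monoˡ-≤ Q slack) ⟩
  2 * (p ⊓ r) + Q + Q + 2 * p * m        ≡⟨ merge (p ⊓ r) m e p ⟩
  2 * (p * m + p ⊓ r + Q)                ∎)
  where
  open ≤-Reasoning
  split : ∀ r m e p → r + suc m * (e + 2 * p) ≡ r + e * m + (e + 2 * p) + 2 * p * m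
  split = solve-∀
  merge : ∀ x m e p → 2 * x + (e + 2 * p) + (e + 2 * p) + 2 * p * m ≡ 2 * (p * m + x + (e + 2 * p))
  merge = solve-∀

-- When m = Q + 1 the product (m + 1) Q is odd, so r is odd; this excludes r = 0 and r = Q - 1.
odd-slack : ∀ {n Q p m r} → Q ≡ 1 + 2 * p → 2 * n ≡ r + suc m * Q → r < Q → m ≤ suc Q →
            r + 1 * m ≤ 2 * (p ⊓ r) + Q
odd-slack {n} {Q} {p} {m} {r} refl 2n≡ r<Q m≤ with m≤n⇒m<n∨m≡n m≤
... | inj₁ m<Q+1 = +-mono-≤ (≤2*⊓ {p} (≤-pred r<Q)) (≤-trans (≤-reflexive (*-identityˡ m)) (≤-pred m<Q+1))
... | inj₂ refl with parity r
...   | inj₁ (j , refl) = ⊥-elim (even≢odd n (j + (1 + 4 * p + 2 * (p * p))) (trans 2n≡ (odd-product j p)))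
  where
  odd-product : ∀ j p → 2 * j + suc (2 + 2 * p) * (1 + 2 * p) ≡ suc (2 * (j + (1 + 4 * p + 2 * (p * p))))
  odd-product = solve-∀
...   | inj₂ (j , refl) = begin
  1 + 2 * j + 1 * (2 + 2 * p)           ≡⟨ regroup j p ⟩
  2 * suc j + (1 + 2 * p)               ≤⟨ +-monoˡ-≤ (1 + 2 * p) (*-monoʳ-≤ 2 (⊓-glb j<p (s≤s (m≤m+n j (j + 0))))) ⟩
  2 * (p ⊓ (1 + 2 * j)) + (1 + 2 * p)   ∎
  where
  open ≤-Reasoning
  j<p : j < p
  j<p = *-cancelˡ-< 2 j p (≤-pred r<Q)
  regroup : ∀ j p → 1 + 2 * j + 1 * (2 + 2 * p) ≡ 2 * suc j + (1 + 2 * p)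
  regroup = solve-∀

halfHeavyProfile : ∀ {n Q p e m r} → Q ≡ e + 2 * p → r < Q → 2 * n ≡ r + suc m * Q →
                   r + e * m ≤ 2 * (p ⊓ r) + Q → StarProfile n Q
halfHeavyProfile {n} {Q} {p} {e} {m} {r} Q≡ r<Q 2n≡ slack =
  windowProfile (≤-trans (m≤m+n p (p + 0)) 2p≤Q) r<Q 2n≡
    (load≤n {n} {Q} {p} {m} {r} 2p≤Q 2n≡) (n≤load+Q {n} {Q} {p} {e} {m} {r} Q≡ 2n≡ slack)
  where
  2p≤Q : 2 * p ≤ Q
  2p≤Q = subst (2 * p ≤_) (sym Q≡) (m≤n+m (2 * p) e)

K-equitableTreeColoring : ∀ n q → (∀ p → suc q ≡ 1 + 2 * p → 2 * n < suc q * (suc q + 3)) →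
                          EquitableTreeColoring (K n) (suc q)
K-equitableTreeColoring n q oddBound =
  starProfile⇒coloring (profile (2 * n / Q) (m≡m%n+[m/n]*n (2 * n) Q))
  where
  Q = suc q
  r = 2 * n % Q
  r<Q : r < Q
  r<Q = m%n<n (2 * n) Q
  profile : ∀ m → 2 * n ≡ r + m * Q → StarProfile n Q
  profile zero    2n≡ = fewColorsProfile (<⇒≤ (subst (_< Q) (sym (trans 2n≡ (+-identityʳ r))) r<Q))
  profile (suc m) 2n≡ with parity Q
  ... | inj₁ (p , Q≡2p)   = halfHeavyProfile {n} {Q} {p} {0} {m} {r} Q≡2p r<Q 2n≡
                              (≤-trans (≤-reflexive (+-identityʳ r)) (≤-trans (<⇒≤ r<Q) (m≤n+m Q _)))
  ... | inj₂ (p , Q≡1+2p) = halfHeavyProfile {n} {Q} {p} {1} {m} {r} Q≡1+2p r<Q 2n≡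
                              (odd-slack {n} {Q} {p} Q≡1+2p 2n≡ r<Q (quotient-bound {n} 2n≡ (oddBound p Q≡1+2p)))

odd-bound : ∀ {t Q p} → Q ≡ 1 + 2 * p → 2 * ((t + 1) / 2) ≤ Q → t + 1 ≤ Q
odd-bound {t} {Q} {p} refl 2h≤Q = begin
  t + 1                          ≡⟨ m≡m%n+[m/n]*n (t + 1) 2 ⟩
  (t + 1) % 2 + (t + 1) / 2 * 2  ≤⟨ +-mono-≤ (≤-pred (m%n<n (t + 1) 2)) (≤-trans (≤-reflexive (*-comm h 2)) (*-monoʳ-≤ 2 h≤p)) ⟩
  1 + 2 * p                      ∎
  where
  open ≤-Reasoning
  h = (t + 1) / 2
  h≤p : h ≤ p
  h≤p = ≤-pred (*-cancelˡ-< 2 h (suc p) (subst (2 * h <_) (sym (*-suc 2 p)) (s≤s 2h≤Q)))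

lemma2p4 : (t n : ℕ) → 1 ≤ n →
    t * (t + 3) ≤ 2 * n → 2 * n < (t + 1) * (t + 4) →
    (q : ℕ) → 1 ≤ q → 2 * ((t + 1) / 2) ≤ q →
    EquitableTreeColoring (K n) q
lemma2p4 t n _ _ 2n< (suc q) _ 2h≤Q = K-equitableTreeColoring n q oddBound
  where
  oddBound : ∀ p → suc q ≡ 1 + 2 * p → 2 * n < suc q * (suc q + 3)
  oddBound p Q≡ = <-≤-trans 2n< (*-mono-≤ t+1≤Q (subst (_≤ suc q + 3) (+-assoc t 1 3) (+-monoˡ-≤ 3 t+1≤Q)))
    where
    t+1≤Q = odd-bound {t} {suc q} {p} Q≡ 2h≤Q
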